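{- Let $n\ge1$ and $\pi\in B_n$. The double coset $\mathbb{U}^C_\pi[\pi]\mathbb{B}_C^+$ of $Sp_{2n}(\mathbb{Z}_2)$ contains an odd coset (a left coset $\tilde A\mathbb{B}_C^+$ with $\tilde A=u[\pi]$, $u\in\mathbb{U}^C_\pi$, all of whose elements have an odd number of $1$'s) if and only if $\pi(2n)=2n$.
   Context: All matrices are over $\mathbb{Z}_2$. Let $J$ be the $n\times n$ antidiagonal matrix of $1$'s, $M=\begin{pmatrix}0&J\\-J&0\end{pmatrix}$, and $Sp_{2n}(\mathbb{Z}_2)=\{A\in SL_{2n}(\mathbb{Z}_2):A^TMA=M\}$. Let $\mathbb{B}_C^+$ be the set of upper triangular matrices in $Sp_{2n}(\mathbb{Z}_2)$ and $\mathbb{U}_C^-$ the set of lower triangular matrices with $1$'s on the diagonal in $Sp_{2n}(\mathbb{Z}_2)$. $B_n$ is the group of permutations $\pi$ of $\{1,\dots,2n\}$ with $\pi(2n+1-i)=2n+1-\pi(i)$ for all $i$; $\pi$ is identified with the permutation matrix $[\pi]$, $[\pi]_{i,j}=1$ iff $i=\pi(j)$. $\mathbb{U}^C_\pi=\mathbb{U}_C^-\cap([\pi]\mathbb{U}_C^-[\pi]^{ -1})$; the double coset $\mathbb{U}^C_\pi[\pi]\mathbb{B}_C^+$ is the union of the left cosets $u[\pi]\mathbb{B}_C^+$, $u\in\mathbb{U}^C_\pi$. -}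

module Defs where

open import Data.Bool using (Bool; true; false; _xor_; _∧_; if_then_else_)
import Data.Nat
open import Data.Nat using (ℕ; zero; suc; _%_) renaming (_+_ to _+ℕ_; _<_ to _<ℕ_)
open import Data.Fin using (Fin; zero; suc; toℕ; splitAt; punchIn; opposite)
open import Data.Fin.Properties using (_≟_)
open import Data.Fin.Permutation using (Permutation′; _⟨$⟩ʳ_; _⟨$⟩ˡ_)
open import Data.Sum using (_⊎_; inj₁; inj₂)
open import Data.Product using (Σ; _×_; _,_; ∃)
open import Relation.Nullary using (does)
open import Relation.Binary.PropositionalEquality using (_≡_)

-- The field Z_2, represented by Bool (false = 0, true = 1).

Z₂ : Set
Z₂ = Bool

infixl 6 _⊕_
_⊕_ : Z₂ → Z₂ → Z₂
_⊕_ = _xor_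

infixl 7 _⊗_
_⊗_ : Z₂ → Z₂ → Z₂
_⊗_ = _∧_

neg : Z₂ → Z₂
neg x = x

Σ[_] : (m : ℕ) → (Fin m → Z₂) → Z₂
Σ[ zero ] f = false
Σ[ suc m ] f = f zero ⊕ Σ[ m ] (λ i → f (suc i))

count : (m : ℕ) → (Fin m → Z₂) → ℕ
count zero f = 0
count (suc m) f = (if f zero then 1 else 0) +ℕ count m (λ i → f (suc i))

Mat : ℕ → Set
Mat m = Fin m → Fin m → Z₂

_≈_ : ∀ {m} → Mat m → Mat m → Set
A ≈ B = ∀ i j → A i j ≡ B i j

infixl 7 _·_
_·_ : ∀ {m} → Mat m → Mat m → Mat m
_·_ {m} A B i k = Σ[ m ] (λ j → A i j ⊗ B j k)

_ᵀ : ∀ {m} → Mat m → Mat m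
(A ᵀ) i j = A j i

-- determinant by Laplace expansion along the first row
-- (over Z_2 all signs are +1)
det : (m : ℕ) → Mat m → Z₂
det zero A = true
det (suc m) A = Σ[ suc m ] (λ j → A zero j ⊗ det m (λ r c → A (suc r) (punchIn j c)))

sumℕ : (m : ℕ) → (Fin m → ℕ) → ℕ
sumℕ zero f = 0
sumℕ (suc m) f = f zero +ℕ sumℕ m (λ i → f (suc i))

ones : ∀ {m} → Mat m → ℕ
ones {m} A = sumℕ m (λ i → count m (λ j → A i j))

Odd : ℕ → Set
Odd k = k % 2 ≡ 1

I : ∀ {m} → Mat m
I i j = does (i ≟ j)

-- The symplectic group Sp_{2n}(Z_2); indices of size-2n matrices live
-- in Fin (n + n), split into the two blocks by splitAt n.

-- J : n×n antidiagonal matrix of ones (0-based: i + j = n - 1)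
Jmat : (n : ℕ) → Mat n
Jmat n i j = does (Data.Nat._≟_ (suc (toℕ i +ℕ toℕ j)) n)

Mmat : (n : ℕ) → Mat (n +ℕ n)
Mmat n i j with splitAt n i | splitAt n j
... | inj₁ a | inj₂ b = Jmat n a b
... | inj₂ a | inj₁ b = neg (Jmat n a b)
... | inj₁ _ | inj₁ _ = false
... | inj₂ _ | inj₂ _ = false

InSL : (m : ℕ) → Mat m → Set
InSL m A = det m A ≡ true

InSp : (n : ℕ) → Mat (n +ℕ n) → Set
InSp n A = InSL (n +ℕ n) A × ((A ᵀ) · Mmat n · A) ≈ Mmat n

UpperTri : ∀ {m} → Mat m → Set
UpperTri A = ∀ i j → toℕ j <ℕ toℕ i → A i j ≡ false

LowerUni : ∀ {m} → Mat m → Set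
LowerUni A = (∀ i j → toℕ i <ℕ toℕ j → A i j ≡ false) × (∀ i → A i i ≡ true)

InBplus : (n : ℕ) → Mat (n +ℕ n) → Set
InBplus n A = InSp n A × UpperTri A

InUminus : (n : ℕ) → Mat (n +ℕ n) → Set
InUminus n A = InSp n A × LowerUni A

-- The hyperoctahedral group B_n inside permutations of Fin (2n).
-- (0-based: the index 2n+1-i becomes opposite i = 2n-1-i.)

InBn : (n : ℕ) → Permutation′ (n +ℕ n) → Set
InBn n π = ∀ i → π ⟨$⟩ʳ (opposite i) ≡ opposite (π ⟨$⟩ʳ i)

[_] : ∀ {m} → Permutation′ m → Mat m
[ π ] i j = does (i ≟ (π ⟨$⟩ʳ j))

[_]⁻¹ : ∀ {m} → Permutation′ m → Mat m
[ π ]⁻¹ i j = does (i ≟ (π ⟨$⟩ˡ j))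

InUπ : (n : ℕ) → Permutation′ (n +ℕ n) → Mat (n +ℕ n) → Set
InUπ n π u = InUminus n u × Σ (Mat (n +ℕ n)) (λ v → InUminus n v × u ≈ ([ π ] · v · [ π ]⁻¹))

OddCoset : (n : ℕ) → Mat (n +ℕ n) → Set
OddCoset n Ã = ∀ b → InBplus n b → Odd (ones (Ã · b))

HasOddCoset : (n : ℕ) → Permutation′ (n +ℕ n) → Set
HasOddCoset n π = ∃ λ u → InUπ n π u × OddCoset n (u · [ π ])

{-# OPTIONS --safe #-}
-- Over Z₂ a matrix has an odd number of ones iff its entries sum to 1, and the entries of X·b sum to
-- Σₖ cₖ rₖ, where c are the column sums of X and r the row sums of b. Every b ∈ B⁺ has
-- r_{2n} = b_{2n,2n} = 1, and 1, 1 + E_{1,2n} and 1 + E_{1,2n+1-q} + E_{q,2n} (1 < q < 2n) lie in B⁺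
-- with r = 𝟙, 𝟙 + e₁ and 𝟙 + e₁ + e_q. Hence X·B⁺ is an odd coset iff c = e_{2n}.
-- For X = u[π] the column sums are those of u permuted by π, and column 2n of the lower unitriangular
-- u sums to 1; so an odd coset forces π⁻¹(2n) = 2n. Conversely, if π fixes 2n (hence 1, as π ∈ Bₙ),
-- the identity with its first column and last row filled with ones is symplectic, commutes with [π],
-- and has column sums e_{2n}.

module Submission where

open import Defs
open import Data.Nat using (ℕ; suc; _≤_; _+_)
open import Data.Fin using (toℕ)
open import Data.Fin.Permutation using (Permutation′; _⟨$⟩ʳ_)
open import Function.Bundles using (_⇔_)
open import Relation.Binary.PropositionalEquality using (_≡_)

open import Algebra.Bundles using (CommutativeRing)
open import Data.Bool using (true; false; not; if_then_else_)
open import Data.Bool.Properties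
  using (not-involutive; not-injective; xor-comm; xor-assoc; xor-same; xor-identityʳ;
         ∧-comm; ∧-zeroʳ; ∧-identityʳ; ∧-distribˡ-xor; ∧-distribʳ-xor; xor-∧-commutativeRing)
open import Data.Empty using (⊥-elim)
open import Data.Fin using (Fin; zero; suc; opposite; punchIn; splitAt; _↑ˡ_; _↑ʳ_)
open import Data.Fin.Properties
  using (_≟_; <⇒≢; ≤∧≢⇒<; punchInᵢ≢i; ≤fromℕ; toℕ-fromℕ; toℕ-injective; toℕ<n;
         toℕ-↑ˡ; toℕ-↑ʳ; opposite-prop; opposite-involutive; ↑ˡ-injective; ↑ʳ-injective;
         splitAt-↑ˡ; splitAt-↑ʳ; splitAt⁻¹-↑ˡ; splitAt⁻¹-↑ʳ)
open import Data.Fin.Permutation using (_⟨$⟩ˡ_; inverseˡ; inverseʳ)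
open import Data.Nat using (zero; z≤n; s≤s; _<_; _∸_; _*_; _%_)
import Data.Nat.Properties as ℕ
open import Data.Sum using (inj₁; inj₂)
open import Data.Product using (_,_; proj₂)
open import Data.Nat.DivMod using (%-distribˡ-+)
open import Function.Base using (_∘_)
open import Function.Bundles using (mk⇔; Equivalence)
open import Relation.Nullary using (yes; no; does)
open import Relation.Nullary.Decidable using (dec-true; dec-false; does-⇔)
open import Relation.Binary.PropositionalEquality
  using (refl; sym; trans; cong; cong₂; subst; _≢_; module ≡-Reasoning)
open import Algebra.Properties.Semiring.Sum (CommutativeRing.semiring xor-∧-commutativeRing)
  using (sum; sum-syntax; sum-cong-≗; sum-replicate; sum-replicate-zero; sum-remove;
         ∑-distrib-+; ∑-comm; *-distribˡ-sum; *-distribʳ-sum)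
open import Algebra.Properties.Monoid.Mult (CommutativeRing.+-monoid xor-∧-commutativeRing)
  using (_×_; ×-homo-+)

private variable
  m m′ : ℕ

-- Sums over Z₂ and the Kronecker delta

Σ≡sum : ∀ m (f : Fin m → Z₂) → Σ[ m ] f ≡ sum f
Σ≡sum zero    f = refl
Σ≡sum (suc m) f = cong (f zero ⊕_) (Σ≡sum m (λ k → f (suc k)))

sum-zero : {f : Fin m → Z₂} → (∀ k → f k ≡ false) → sum f ≡ false
sum-zero {m} f≗0 = trans (sum-cong-≗ f≗0) (sum-replicate-zero m)

Σ-zero : ∀ m {f : Fin m → Z₂} → (∀ k → f k ≡ false) → Σ[ m ] f ≡ false
Σ-zero m f≗0 = trans (Σ≡sum m _) (sum-zero f≗0)

sum-single : ∀ {f : Fin m → Z₂} a → (∀ k → k ≢ a → f k ≡ false) → sum f ≡ f a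
sum-single {suc m} {f} a vanishes = begin
  sum f                              ≡⟨ sum-remove {i = a} f ⟩
  f a ⊕ sum (λ k → f (punchIn a k))  ≡⟨ cong (f a ⊕_) (sum-zero (vanishes _ ∘ punchInᵢ≢i a)) ⟩
  f a ⊕ false                        ≡⟨ xor-identityʳ (f a) ⟩
  f a                                ∎
  where open ≡-Reasoning

sum-true-even : ∀ n → ∑[ l < n + n ] true ≡ false
sum-true-even n = trans (sum-replicate (n + n)) (trans (×-homo-+ true n n) (xor-same (n × true)))

δ : Fin m → Fin m → Z₂
δ a b = does (a ≟ b)

δ-refl : (a : Fin m) → δ a a ≡ true
δ-refl a = dec-true (a ≟ a) refl

δ-≢ : {a b : Fin m} → a ≢ b → δ a b ≡ false
δ-≢ = dec-false (_ ≟ _)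

δ-⇔ : {a b : Fin m} {c d : Fin m′} → (a ≡ b ⇔ c ≡ d) → δ a b ≡ δ c d
δ-⇔ a≡b⇔c≡d = does-⇔ a≡b⇔c≡d (_ ≟ _) (_ ≟ _)

δ-sym : (a b : Fin m) → δ a b ≡ δ b a
δ-sym a b = δ-⇔ {a = a} {b} {b} {a} (mk⇔ sym sym)

δ≡true : {a b : Fin m} → δ a b ≡ true → a ≡ b
δ≡true {a = a} {b} with a ≟ b
... | yes a≡b = λ _ → a≡b
... | no _    = λ ()

δ-fixed : (σ : Fin m → Fin m) → (∀ x y → δ (σ x) (σ y) ≡ δ x y) →
  ∀ {a} → σ a ≡ a → ∀ x → δ (σ x) a ≡ δ x a
δ-fixed σ σ-δ {a} σa≡a x = trans (cong (δ (σ x)) (sym σa≡a)) (σ-δ x a)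

sum-δʳ : (f : Fin m → Z₂) (a : Fin m) → ∑[ k < m ] (f k ⊗ δ k a) ≡ f a
sum-δʳ f a = trans (sum-single a (λ k k≢a → trans (cong (f k ⊗_) (δ-≢ k≢a)) (∧-zeroʳ (f k))))
                   (trans (cong (f a ⊗_) (δ-refl a)) (∧-identityʳ (f a)))

sum-δˡ : (f : Fin m → Z₂) (a : Fin m) → ∑[ k < m ] (δ k a ⊗ f k) ≡ f a
sum-δˡ f a = trans (sum-cong-≗ (λ k → ∧-comm (δ k a) (f k))) (sum-δʳ f a)

sum-δ : (a : Fin m) → ∑[ k < m ] δ k a ≡ true
sum-δ a = sum-δʳ (λ _ → true) a

-- Parity of the number of ones

bit : Z₂ → ℕ
bit b = if b then 1 else 0

bit-%2 : ∀ x → bit x % 2 ≡ bit x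
bit-%2 true  = refl
bit-%2 false = refl

bit-⊕ : ∀ x y → (bit x + bit y) % 2 ≡ bit (x ⊕ y)
bit-⊕ true  true  = refl
bit-⊕ true  false = refl
bit-⊕ false true  = refl
bit-⊕ false false = refl

sumℕ-%2 : ∀ m (g : Fin m → ℕ) (h : Fin m → Z₂) → (∀ i → g i % 2 ≡ bit (h i)) →
  sumℕ m g % 2 ≡ bit (sum h)
sumℕ-%2 zero    g h g≡h = refl
sumℕ-%2 (suc m) g h g≡h = begin
  (g zero + sumℕ m (λ i → g (suc i))) % 2
    ≡⟨ %-distribˡ-+ (g zero) (sumℕ m (λ i → g (suc i))) 2 ⟩
  (g zero % 2 + sumℕ m (λ i → g (suc i)) % 2) % 2
    ≡⟨ cong₂ (λ x y → (x + y) % 2) (g≡h zero) (sumℕ-%2 m _ _ (λ i → g≡h (suc i))) ⟩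
  (bit (h zero) + bit (sum (λ i → h (suc i)))) % 2
    ≡⟨ bit-⊕ (h zero) _ ⟩
  bit (sum h) ∎
  where open ≡-Reasoning

count≡sumℕ : ∀ m (f : Fin m → Z₂) → count m f ≡ sumℕ m (λ i → bit (f i))
count≡sumℕ zero    f = refl
count≡sumℕ (suc m) f = cong (bit (f zero) +_) (count≡sumℕ m (λ i → f (suc i)))

total : Mat m → Z₂
total {m} A = ∑[ i < m ] ∑[ j < m ] A i j

ones-%2 : (A : Mat m) → ones A % 2 ≡ bit (total A)
ones-%2 {m} A = sumℕ-%2 m _ _ (λ i → trans (cong (_% 2) (count≡sumℕ m (A i)))
                                            (sumℕ-%2 m _ (A i) (λ j → bit-%2 (A i j))))

odd-ones⇔total : (A : Mat m) → Odd (ones A) ⇔ total A ≡ true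
odd-ones⇔total A = mk⇔ (λ odd → bit≡1 (trans (sym (ones-%2 A)) odd))
                       (λ total≡true → trans (ones-%2 A) (cong bit total≡true))
  where
  bit≡1 : ∀ {x} → bit x ≡ 1 → x ≡ true
  bit≡1 {true} _ = refl

col : Mat m → Fin m → Fin m → Z₂
col A i l = A l i

colsum rowsum : Mat m → Fin m → Z₂
colsum {m} A k = ∑[ i < m ] A i k
rowsum {m} A k = ∑[ j < m ] A k j

·-entry : (A B : Mat m) (i k : Fin m) → (A · B) i k ≡ ∑[ j < m ] (A i j ⊗ B j k)
·-entry {m} A B i k = Σ≡sum m _

total-· : (X B : Mat m) → total (X · B) ≡ ∑[ k < m ] (colsum X k ⊗ rowsum B k)
total-· {m} X B = begin
  ∑[ i < m ] ∑[ j < m ] (X · B) i j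
    ≡⟨ sum-cong-≗ (λ i → sum-cong-≗ (·-entry X B i)) ⟩
  ∑[ i < m ] ∑[ j < m ] ∑[ k < m ] (X i k ⊗ B k j)
    ≡⟨ sum-cong-≗ (λ i → ∑-comm (λ j k → X i k ⊗ B k j)) ⟩
  ∑[ i < m ] ∑[ k < m ] ∑[ j < m ] (X i k ⊗ B k j)
    ≡⟨ sum-cong-≗ (λ i → sum-cong-≗ (λ k → *-distribˡ-sum (X i k) (B k))) ⟨
  ∑[ i < m ] ∑[ k < m ] (X i k ⊗ rowsum B k)
    ≡⟨ ∑-comm (λ i k → X i k ⊗ rowsum B k) ⟩
  ∑[ k < m ] ∑[ i < m ] (X i k ⊗ rowsum B k)
    ≡⟨ sum-cong-≗ (λ k → *-distribʳ-sum (rowsum B k) (col X k)) ⟨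
  ∑[ k < m ] (colsum X k ⊗ rowsum B k) ∎
  where open ≡-Reasoning

-- Determinants of unitriangular matrices

minor : Mat (suc m) → Fin (suc m) → Mat m
minor A j r c = A (suc r) (punchIn j c)

det-zero-column : ∀ m (A : Mat (suc m)) → (∀ r → A r zero ≡ false) → det (suc m) A ≡ false
det-zero-column zero    A col≡0 = cong (λ x → x ⊗ true ⊕ false) (col≡0 zero)
det-zero-column (suc m) A col≡0 =
  cong₂ _⊕_ (cong (_⊗ det (suc m) (minor A zero)) (col≡0 zero)) (Σ-zero (suc m) minor≡0)
  where
  minor≡0 : ∀ k → A zero (suc k) ⊗ det (suc m) (minor A (suc k)) ≡ false
  minor≡0 k = trans (cong (A zero (suc k) ⊗_) (det-zero-column m (minor A (suc k)) (col≡0 ∘ suc)))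
                    (∧-zeroʳ _)

det-upper-unitriangular : ∀ m (A : Mat m) → UpperTri A → (∀ i → A i i ≡ true) → det m A ≡ true
det-upper-unitriangular zero    A upper diag = refl
det-upper-unitriangular (suc m) A upper diag =
  cong₂ _⊕_ (cong₂ _⊗_ (diag zero) (det-upper-unitriangular m (minor A zero)
                                      (λ i j j<i → upper (suc i) (suc j) (s≤s j<i)) (diag ∘ suc)))
            (Σ-zero m (minor≡0 m A upper))
  where
  minor≡0 : ∀ m (A : Mat (suc m)) → UpperTri A → ∀ k → A zero (suc k) ⊗ det m (minor A (suc k)) ≡ false
  minor≡0 (suc m) A upper k =
    trans (cong (A zero (suc k) ⊗_)
                (det-zero-column m (minor A (suc k)) (λ r → upper (suc r) zero (s≤s z≤n))))
          (∧-zeroʳ _)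

det-lower-unitriangular : ∀ m (A : Mat m) → LowerUni A → det m A ≡ true
det-lower-unitriangular zero    A lower = refl
det-lower-unitriangular (suc m) A (upper≡0 , diag) =
  cong₂ _⊕_ (cong₂ _⊗_ (diag zero) (det-lower-unitriangular m (minor A zero)
                                      ((λ i j i<j → upper≡0 (suc i) (suc j) (s≤s i<j)) , diag ∘ suc)))
            (Σ-zero m (λ k → cong (_⊗ det m (minor A (suc k))) (upper≡0 zero (suc k) (s≤s z≤n))))

-- The form M

opposite-spec : (i j : Fin m) → suc (toℕ i + toℕ j) ≡ m ⇔ i ≡ opposite j
opposite-spec {m} i j = mk⇔ from to
  where
  to : i ≡ opposite j → suc (toℕ i + toℕ j) ≡ m
  to refl = begin
    suc (toℕ (opposite j) + toℕ j)    ≡⟨ ℕ.+-suc (toℕ (opposite j)) (toℕ j) ⟨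
    toℕ (opposite j) + suc (toℕ j)    ≡⟨ cong (_+ suc (toℕ j)) (opposite-prop j) ⟩
    m ∸ suc (toℕ j) + suc (toℕ j)     ≡⟨ ℕ.m∸n+n≡m (toℕ<n j) ⟩
    m                                 ∎
    where open ≡-Reasoning
  from : suc (toℕ i + toℕ j) ≡ m → i ≡ opposite j
  from i+j+1≡m = toℕ-injective (begin
    toℕ i                             ≡⟨ ℕ.m+n∸n≡m (toℕ i) (suc (toℕ j)) ⟨
    toℕ i + suc (toℕ j) ∸ suc (toℕ j) ≡⟨ cong (_∸ suc (toℕ j)) (trans (ℕ.+-suc (toℕ i) _) i+j+1≡m) ⟩
    m ∸ suc (toℕ j)                   ≡⟨ opposite-prop j ⟨
    toℕ (opposite j)                  ∎)
    where open ≡-Reasoning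

δ-opposite : (i a : Fin m) → δ (opposite i) a ≡ δ i (opposite a)
δ-opposite i a = δ-⇔ (mk⇔ (λ e → trans (sym (opposite-involutive i)) (cong opposite e))
                          (λ e → trans (cong opposite e) (opposite-involutive a)))

opposite-≢ : ∀ {n} (q : Fin (n + n)) → opposite q ≢ q
opposite-≢ {n} q q̄≡q = ℕ.even≢odd n (toℕ q) (begin
  2 * n                    ≡⟨ double n ⟨
  n + n                    ≡⟨ Equivalence.from (opposite-spec q q) (sym q̄≡q) ⟨
  suc (toℕ q + toℕ q)      ≡⟨ cong suc (double (toℕ q)) ⟩
  suc (2 * toℕ q)          ∎)
  where
  open ≡-Reasoning
  double : ∀ x → x + x ≡ 2 * x
  double x = cong (x +_) (sym (ℕ.+-identityʳ x))

Jmat-opposite : ∀ m (a b : Fin m) → Jmat m a b ≡ δ a (opposite b)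
Jmat-opposite m a b = does-⇔ (opposite-spec a b) (suc (toℕ a + toℕ b) ℕ.≟ m) (a ≟ opposite b)

opposite-↑ˡ : ∀ {n} (a : Fin n) → opposite (a ↑ˡ n) ≡ n ↑ʳ opposite a
opposite-↑ˡ {n} a = toℕ-injective (begin
  toℕ (opposite (a ↑ˡ n))     ≡⟨ opposite-prop (a ↑ˡ n) ⟩
  n + n ∸ suc (toℕ (a ↑ˡ n))  ≡⟨ cong (λ x → n + n ∸ suc x) (toℕ-↑ˡ a n) ⟩
  n + n ∸ suc (toℕ a)         ≡⟨ ℕ.+-∸-assoc n (toℕ<n a) ⟩
  n + (n ∸ suc (toℕ a))       ≡⟨ cong (n +_) (opposite-prop a) ⟨
  n + toℕ (opposite a)        ≡⟨ toℕ-↑ʳ n (opposite a) ⟨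
  toℕ (n ↑ʳ opposite a)       ∎)
  where open ≡-Reasoning

opposite-↑ʳ : ∀ {n} (b : Fin n) → opposite (n ↑ʳ b) ≡ opposite b ↑ˡ n
opposite-↑ʳ {n} b = begin
  opposite (n ↑ʳ b)                        ≡⟨ cong (λ x → opposite (n ↑ʳ x)) (opposite-involutive b) ⟨
  opposite (n ↑ʳ opposite (opposite b))    ≡⟨ cong opposite (opposite-↑ˡ (opposite b)) ⟨
  opposite (opposite (opposite b ↑ˡ n))    ≡⟨ opposite-involutive _ ⟩
  opposite b ↑ˡ n                          ∎
  where open ≡-Reasoning

↑ˡ≢↑ʳ : ∀ {n} (a b : Fin n) → a ↑ˡ n ≢ n ↑ʳ b
↑ˡ≢↑ʳ {n} a b a≡b
  with trans (sym (splitAt-↑ˡ n a n)) (trans (cong (splitAt n) a≡b) (splitAt-↑ʳ n n b))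
... | ()

Mmat-opposite : ∀ n (i j : Fin (n + n)) → Mmat n i j ≡ δ i (opposite j)
Mmat-opposite n i j with splitAt n i in split-i | splitAt n j in split-j
... | inj₁ a | inj₁ b = begin
  false                              ≡⟨ δ-≢ (↑ˡ≢↑ʳ a (opposite b)) ⟨
  δ (a ↑ˡ n) (n ↑ʳ opposite b)       ≡⟨ cong (δ (a ↑ˡ n)) (opposite-↑ˡ b) ⟨
  δ (a ↑ˡ n) (opposite (b ↑ˡ n))
    ≡⟨ cong₂ (λ x y → δ x (opposite y)) (splitAt⁻¹-↑ˡ split-i) (splitAt⁻¹-↑ˡ split-j) ⟩
  δ i (opposite j)                   ∎
  where open ≡-Reasoning
... | inj₁ a | inj₂ b = begin
  Jmat n a b                         ≡⟨ Jmat-opposite n a b ⟩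
  δ a (opposite b)                   ≡⟨ δ-⇔ (mk⇔ (↑ˡ-injective n a (opposite b)) (cong (_↑ˡ n))) ⟨
  δ (a ↑ˡ n) (opposite b ↑ˡ n)       ≡⟨ cong (δ (a ↑ˡ n)) (opposite-↑ʳ b) ⟨
  δ (a ↑ˡ n) (opposite (n ↑ʳ b))
    ≡⟨ cong₂ (λ x y → δ x (opposite y)) (splitAt⁻¹-↑ˡ split-i) (splitAt⁻¹-↑ʳ split-j) ⟩
  δ i (opposite j)                   ∎
  where open ≡-Reasoning
... | inj₂ a | inj₁ b = begin
  Jmat n a b                         ≡⟨ Jmat-opposite n a b ⟩
  δ a (opposite b)                   ≡⟨ δ-⇔ (mk⇔ (↑ʳ-injective n a (opposite b)) (cong (n ↑ʳ_))) ⟨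
  δ (n ↑ʳ a) (n ↑ʳ opposite b)       ≡⟨ cong (δ (n ↑ʳ a)) (opposite-↑ˡ b) ⟨
  δ (n ↑ʳ a) (opposite (b ↑ˡ n))
    ≡⟨ cong₂ (λ x y → δ x (opposite y)) (splitAt⁻¹-↑ʳ split-i) (splitAt⁻¹-↑ˡ split-j) ⟩
  δ i (opposite j)                   ∎
  where open ≡-Reasoning
... | inj₂ a | inj₂ b = begin
  false                              ≡⟨ δ-≢ (↑ˡ≢↑ʳ (opposite b) a ∘ sym) ⟨
  δ (n ↑ʳ a) (opposite b ↑ˡ n)       ≡⟨ cong (δ (n ↑ʳ a)) (opposite-↑ʳ b) ⟨
  δ (n ↑ʳ a) (opposite (n ↑ʳ b))
    ≡⟨ cong₂ (λ x y → δ x (opposite y)) (splitAt⁻¹-↑ʳ split-i) (splitAt⁻¹-↑ʳ split-j) ⟩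
  δ i (opposite j)                   ∎
  where open ≡-Reasoning

⟪_,_⟫ : (x y : Fin m → Z₂) → Z₂
⟪_,_⟫ {m} x y = ∑[ l < m ] (x (opposite l) ⊗ y l)

symplectic-entry : ∀ n (A : Mat (n + n)) i j → ((A ᵀ) · Mmat n · A) i j ≡ ⟪ col A i , col A j ⟫
symplectic-entry n A i j =
  trans (·-entry ((A ᵀ) · Mmat n) A i j) (sum-cong-≗ (λ l → cong (_⊗ A l j) (AᵀM-entry l)))
  where
  AᵀM-entry : ∀ l → ((A ᵀ) · Mmat n) i l ≡ A (opposite l) i
  AᵀM-entry l = trans (·-entry (A ᵀ) (Mmat n) i l)
                      (trans (sum-cong-≗ (λ k → cong (A k i ⊗_) (Mmat-opposite n k l)))
                             (sum-δʳ (col A i) (opposite l)))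

⟪⟫-⊕ˡ : (x x′ y : Fin m → Z₂) →
  ⟪ (λ l → x l ⊕ x′ l) , y ⟫ ≡ ⟪ x , y ⟫ ⊕ ⟪ x′ , y ⟫
⟪⟫-⊕ˡ x x′ y = trans (sum-cong-≗ (λ l → ∧-distribʳ-xor (y l) (x (opposite l)) (x′ (opposite l))))
                     (∑-distrib-+ (λ l → x (opposite l) ⊗ y l) (λ l → x′ (opposite l) ⊗ y l))

⟪⟫-⊕ʳ : (x y y′ : Fin m → Z₂) →
  ⟪ x , (λ l → y l ⊕ y′ l) ⟫ ≡ ⟪ x , y ⟫ ⊕ ⟪ x , y′ ⟫
⟪⟫-⊕ʳ x y y′ = trans (sum-cong-≗ (λ l → ∧-distribˡ-xor (x (opposite l)) (y l) (y′ l)))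
                     (∑-distrib-+ (λ l → x (opposite l) ⊗ y l) (λ l → x (opposite l) ⊗ y′ l))

⟪δ,⟫ : (i : Fin m) (y : Fin m → Z₂) → ⟪ (λ l → δ l i) , y ⟫ ≡ y (opposite i)
⟪δ,⟫ i y = trans (sum-cong-≗ (λ l → cong (_⊗ y l) (δ-opposite l i))) (sum-δˡ y (opposite i))

⟪,δ⟫ : (x : Fin m → Z₂) (j : Fin m) → ⟪ x , (λ l → δ l j) ⟫ ≡ x (opposite j)
⟪,δ⟫ x j = sum-δʳ (λ l → x (opposite l)) j

infixl 6 _⊕ᴹ_
_⊕ᴹ_ : Mat m → Mat m → Mat m
(A ⊕ᴹ B) i j = A i j ⊕ B i j

-- M E is symmetric, resp. Eᵀ M E = 0: (M E) i j = E (opposite i) j and ⟪ x , y ⟫ = xᵀ M y.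
MSymmetric : Mat m → Set
MSymmetric E = ∀ i j → E (opposite i) j ≡ E (opposite j) i

Isotropic : Mat m → Set
Isotropic E = ∀ i j → ⟪ col E i , col E j ⟫ ≡ false

StrictlyUpper StrictlyLower : Mat m → Set
StrictlyUpper E = ∀ i j → toℕ j ≤ toℕ i → E i j ≡ false
StrictlyLower E = ∀ i j → toℕ i ≤ toℕ j → E i j ≡ false

-- (I + E)ᵀ M (I + E) = M + ((M E)ᵀ + M E) + Eᵀ M E over Z₂, as M is symmetric.
I⊕-symplectic : ∀ n (E : Mat (n + n)) → MSymmetric E → Isotropic E →
  ((I ⊕ᴹ E) ᵀ · Mmat n · (I ⊕ᴹ E)) ≈ Mmat n
I⊕-symplectic n E E-sym E-iso i j = begin
  ((I ⊕ᴹ E) ᵀ · Mmat n · (I ⊕ᴹ E)) i j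
    ≡⟨ symplectic-entry n (I ⊕ᴹ E) i j ⟩
  ⟪ (λ l → δ l i ⊕ E l i) , (λ l → δ l j ⊕ E l j) ⟫
    ≡⟨ ⟪⟫-⊕ˡ (λ l → δ l i) (col E i) (λ l → δ l j ⊕ E l j) ⟩
  ⟪ (λ l → δ l i) , (λ l → δ l j ⊕ E l j) ⟫ ⊕ ⟪ col E i , (λ l → δ l j ⊕ E l j) ⟫
    ≡⟨ cong₂ _⊕_ (⟪δ,⟫ i _) (⟪⟫-⊕ʳ (col E i) (λ l → δ l j) (col E j)) ⟩
  (δ (opposite i) j ⊕ E (opposite i) j) ⊕ (⟪ col E i , (λ l → δ l j) ⟫ ⊕ ⟪ col E i , col E j ⟫)
    ≡⟨ cong (δ (opposite i) j ⊕ E (opposite i) j ⊕_) (cong₂ _⊕_ (⟪,δ⟫ (col E i) j) (E-iso i j)) ⟩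
  (δ (opposite i) j ⊕ E (opposite i) j) ⊕ (E (opposite j) i ⊕ false)
    ≡⟨ cong (λ x → δ (opposite i) j ⊕ E (opposite i) j ⊕ (x ⊕ false)) (E-sym i j) ⟨
  (δ (opposite i) j ⊕ E (opposite i) j) ⊕ (E (opposite i) j ⊕ false)
    ≡⟨ cancel (δ (opposite i) j) (E (opposite i) j) ⟩
  δ (opposite i) j
    ≡⟨ δ-opposite i j ⟩
  δ i (opposite j)
    ≡⟨ Mmat-opposite n i j ⟨
  Mmat n i j ∎
  where
  open ≡-Reasoning
  cancel : ∀ d x → (d ⊕ x) ⊕ (x ⊕ false) ≡ d
  cancel d x = trans (cong (d ⊕ x ⊕_) (xor-identityʳ x))
                     (trans (xor-assoc d x x) (trans (cong (d ⊕_) (xor-same x)) (xor-identityʳ d)))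

I⊕-InBplus : ∀ n (E : Mat (n + n)) → StrictlyUpper E → MSymmetric E → Isotropic E →
  InBplus n (I ⊕ᴹ E)
I⊕-InBplus n E E-upper E-sym E-iso =
  (det-upper-unitriangular (n + n) (I ⊕ᴹ E) upper diag , I⊕-symplectic n E E-sym E-iso) , upper
  where
  upper : UpperTri (I ⊕ᴹ E)
  upper i j j<i = cong₂ _⊕_ (δ-≢ (<⇒≢ j<i ∘ sym)) (E-upper i j (ℕ.<⇒≤ j<i))
  diag : ∀ i → (I ⊕ᴹ E) i i ≡ true
  diag i = cong₂ _⊕_ (δ-refl i) (E-upper i i ℕ.≤-refl)

I⊕-InUminus : ∀ n (E : Mat (n + n)) → StrictlyLower E → MSymmetric E → Isotropic E →
  InUminus n (I ⊕ᴹ E)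
I⊕-InUminus n E E-lower E-sym E-iso =
  (det-lower-unitriangular (n + n) (I ⊕ᴹ E) unitriangular , I⊕-symplectic n E E-sym E-iso)
  , unitriangular
  where
  unitriangular : LowerUni (I ⊕ᴹ E)
  unitriangular = (λ i j i<j → cong₂ _⊕_ (δ-≢ (<⇒≢ i<j)) (E-lower i j (ℕ.<⇒≤ i<j)))
                , (λ i → cong₂ _⊕_ (δ-refl i) (E-lower i i ℕ.≤-refl))

rowsum-I⊕ : (E : Mat m) (k : Fin m) → rowsum (I ⊕ᴹ E) k ≡ true ⊕ rowsum E k
rowsum-I⊕ E k =
  trans (∑-distrib-+ (I k) (E k)) (cong (_⊕ rowsum E k) (trans (sum-cong-≗ (δ-sym k)) (sum-δ k)))

colsum-I⊕ : (E : Mat m) (k : Fin m) → colsum (I ⊕ᴹ E) k ≡ true ⊕ colsum E k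
colsum-I⊕ E k = trans (∑-distrib-+ (col I k) (col E k)) (cong (_⊕ colsum E k) (sum-δ k))

-- Matrix units

E[_,_] : Fin m → Fin m → Mat m
E[ a , b ] i j = δ i a ⊗ δ j b

rowsum-E : (a b k : Fin m) → rowsum E[ a , b ] k ≡ δ k a
rowsum-E a b k = trans (sym (*-distribˡ-sum (δ k a) (λ j → δ j b)))
                       (trans (cong (δ k a ⊗_) (sum-δ b)) (∧-identityʳ (δ k a)))

E-strictlyUpper : {a b : Fin m} → toℕ a < toℕ b → StrictlyUpper E[ a , b ]
E-strictlyUpper {a = a} {b} a<b i j j≤i with i ≟ a | j ≟ b
... | yes refl | yes refl = ⊥-elim (ℕ.<⇒≱ a<b j≤i)
... | yes _    | no _     = refl
... | no _     | _        = refl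

⊕ᴹ-strictlyUpper : {E F : Mat m} → StrictlyUpper E → StrictlyUpper F → StrictlyUpper (E ⊕ᴹ F)
⊕ᴹ-strictlyUpper E-upper F-upper i j j≤i = cong₂ _⊕_ (E-upper i j j≤i) (F-upper i j j≤i)

δ-annihilate : (l : Fin m) {a b : Fin m} (x y : Z₂) → a ≢ b →
  (δ l a ⊗ x) ⊗ (δ l b ⊗ y) ≡ false
δ-annihilate l {a} x y a≢b with l ≟ a
... | yes refl = trans (cong (λ z → x ⊗ (z ⊗ y)) (δ-≢ a≢b)) (∧-zeroʳ x)
... | no _     = refl

δδ-annihilate : (l : Fin m) {a a′ b b′ : Fin m} (x x′ y y′ : Z₂) →
  a ≢ b → a ≢ b′ → a′ ≢ b → a′ ≢ b′ →
  (δ l a ⊗ x ⊕ δ l a′ ⊗ x′) ⊗ (δ l b ⊗ y ⊕ δ l b′ ⊗ y′) ≡ false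
δδ-annihilate l {a} {a′} {b} {b′} x x′ y y′ a≢b a≢b′ a′≢b a′≢b′ = begin
  (P ⊕ P′) ⊗ (Q ⊕ Q′)
    ≡⟨ ∧-distribʳ-xor (Q ⊕ Q′) P P′ ⟩
  P ⊗ (Q ⊕ Q′) ⊕ P′ ⊗ (Q ⊕ Q′)
    ≡⟨ cong₂ _⊕_ (∧-distribˡ-xor P Q Q′) (∧-distribˡ-xor P′ Q Q′) ⟩
  (P ⊗ Q ⊕ P ⊗ Q′) ⊕ (P′ ⊗ Q ⊕ P′ ⊗ Q′)
    ≡⟨ cong₂ _⊕_ (cong₂ _⊕_ (δ-annihilate l x y a≢b) (δ-annihilate l x y′ a≢b′))
                 (cong₂ _⊕_ (δ-annihilate l x′ y a′≢b) (δ-annihilate l x′ y′ a′≢b′)) ⟩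
  false ∎
  where
  open ≡-Reasoning
  P = δ l a ⊗ x
  P′ = δ l a′ ⊗ x′
  Q = δ l b ⊗ y
  Q′ = δ l b′ ⊗ y′

T[_] : Fin m → Mat m
T[ a ] = E[ a , opposite a ]

T-MSymmetric : (a : Fin m) → MSymmetric T[ a ]
T-MSymmetric a i j = begin
  δ (opposite i) a ⊗ δ j (opposite a)    ≡⟨ cong (_⊗ δ j (opposite a)) (δ-opposite i a) ⟩
  δ i (opposite a) ⊗ δ j (opposite a)    ≡⟨ ∧-comm (δ i (opposite a)) (δ j (opposite a)) ⟩
  δ j (opposite a) ⊗ δ i (opposite a)    ≡⟨ cong (_⊗ δ i (opposite a)) (δ-opposite j a) ⟨
  δ (opposite j) a ⊗ δ i (opposite a)    ∎
  where open ≡-Reasoning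

T-isotropic : ∀ n (a : Fin (n + n)) → Isotropic T[ a ]
T-isotropic n a i j = sum-zero λ l →
  trans (cong (λ x → x ⊗ δ i (opposite a) ⊗ (δ l a ⊗ δ j (opposite a))) (δ-opposite l a))
        (δ-annihilate l (δ i (opposite a)) (δ j (opposite a)) (opposite-≢ {n} a))

S[_,_] : Fin m → Fin m → Mat m
S[ a , c ] = E[ a , opposite c ] ⊕ᴹ E[ c , opposite a ]

S-opposite : (a c i j : Fin m) →
  S[ a , c ] (opposite i) j ≡ δ i (opposite a) ⊗ δ j (opposite c) ⊕ δ i (opposite c) ⊗ δ j (opposite a)
S-opposite a c i j = cong₂ _⊕_ (cong (_⊗ δ j (opposite c)) (δ-opposite i a))
                               (cong (_⊗ δ j (opposite a)) (δ-opposite i c))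

S-MSymmetric : (a c : Fin m) → MSymmetric S[ a , c ]
S-MSymmetric a c i j = begin
  S[ a , c ] (opposite i) j
    ≡⟨ S-opposite a c i j ⟩
  δ i (opposite a) ⊗ δ j (opposite c) ⊕ δ i (opposite c) ⊗ δ j (opposite a)
    ≡⟨ xor-comm (δ i (opposite a) ⊗ δ j (opposite c)) _ ⟩
  δ i (opposite c) ⊗ δ j (opposite a) ⊕ δ i (opposite a) ⊗ δ j (opposite c)
    ≡⟨ cong₂ _⊕_ (∧-comm (δ i (opposite c)) _) (∧-comm (δ i (opposite a)) _) ⟩
  δ j (opposite a) ⊗ δ i (opposite c) ⊕ δ j (opposite c) ⊗ δ i (opposite a)
    ≡⟨ S-opposite a c j i ⟨
  S[ a , c ] (opposite j) i ∎
  where open ≡-Reasoning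

S-isotropic : ∀ n {a c : Fin (n + n)} → a ≢ opposite c → Isotropic S[ a , c ]
S-isotropic n {a} {c} a≢c̄ i j = sum-zero λ l →
  trans (cong (_⊗ S[ a , c ] l j) (S-opposite a c l i))
        (δδ-annihilate l (δ i (opposite c)) (δ i (opposite a)) (δ j (opposite c)) (δ j (opposite a))
                       (opposite-≢ {n} a) ā≢c (ā≢c ∘ flip-≡) (opposite-≢ {n} c))
  where
  ā≢c : opposite a ≢ c
  ā≢c ā≡c = a≢c̄ (trans (sym (opposite-involutive a)) (cong opposite ā≡c))
  flip-≡ : opposite c ≡ a → opposite a ≡ c
  flip-≡ c̄≡a = trans (cong opposite (sym c̄≡a)) (opposite-involutive c)

rowsum-S : (a c k : Fin m) → rowsum S[ a , c ] k ≡ δ k a ⊕ δ k c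
rowsum-S a c k = trans (∑-distrib-+ (E[ a , opposite c ] k) (E[ c , opposite a ] k))
                       (cong₂ _⊕_ (rowsum-E a (opposite c) k) (rowsum-E c (opposite a) k))

-- Permutation matrices

δ-⟨$⟩ : (π : Permutation′ m) (a b : Fin m) → δ a (π ⟨$⟩ʳ b) ≡ δ (π ⟨$⟩ˡ a) b
δ-⟨$⟩ π a b = δ-⇔ (mk⇔ (λ e → trans (cong (π ⟨$⟩ˡ_) e) (inverseˡ π))
                       (λ e → trans (sym (inverseʳ π)) (cong (π ⟨$⟩ʳ_) e)))

δ-⟨$⟩ʳ : (π : Permutation′ m) (x y : Fin m) → δ (π ⟨$⟩ʳ x) (π ⟨$⟩ʳ y) ≡ δ x y
δ-⟨$⟩ʳ π x y = trans (δ-⟨$⟩ π (π ⟨$⟩ʳ x) y) (cong (λ z → δ z y) (inverseˡ π))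

δ-⟨$⟩ˡ : (π : Permutation′ m) (x y : Fin m) → δ (π ⟨$⟩ˡ x) (π ⟨$⟩ˡ y) ≡ δ x y
δ-⟨$⟩ˡ π x y = trans (sym (δ-⟨$⟩ π x (π ⟨$⟩ˡ y))) (cong (δ x) (inverseʳ π))

[π]·-entry : (π : Permutation′ m) (v : Mat m) (i k : Fin m) → ([ π ] · v) i k ≡ v (π ⟨$⟩ˡ i) k
[π]·-entry π v i k =
  trans (·-entry [ π ] v i k)
        (trans (sum-cong-≗ (λ j → cong (_⊗ v j k) (trans (δ-⟨$⟩ π i j) (δ-sym _ j))))
               (sum-δˡ (λ j → v j k) (π ⟨$⟩ˡ i)))

conjugate-entry : (π : Permutation′ m) (v : Mat m) (i j : Fin m) →
  ([ π ] · v · [ π ]⁻¹) i j ≡ v (π ⟨$⟩ˡ i) (π ⟨$⟩ˡ j)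
conjugate-entry π v i j =
  trans (·-entry ([ π ] · v) [ π ]⁻¹ i j)
        (trans (sum-cong-≗ (λ k → cong (_⊗ δ k (π ⟨$⟩ˡ j)) ([π]·-entry π v i k)))
               (sum-δʳ (v (π ⟨$⟩ˡ i)) (π ⟨$⟩ˡ j)))

colsum-·[π] : (π : Permutation′ m) (X : Mat m) (k : Fin m) →
  colsum (X · [ π ]) k ≡ colsum X (π ⟨$⟩ʳ k)
colsum-·[π] π X k = sum-cong-≗ (λ i → trans (·-entry X [ π ] i k) (sum-δʳ (X i) (π ⟨$⟩ʳ k)))

-- Odd cosets for n = k + 1

module _ (k : ℕ) where
  private
    n N : ℕ
    n = suc k
    N = n + n

  -- The paper's indices 1 and 2n.
  first last : Fin N
  first = zero
  last  = opposite first

  suc-toℕ-last : suc (toℕ last) ≡ n + n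
  suc-toℕ-last = cong suc (toℕ-fromℕ _)

  last-unique : ∀ {i} → suc (toℕ i) ≡ n + n → i ≡ last
  last-unique i-last = toℕ-injective (ℕ.suc-injective (trans i-last (sym suc-toℕ-last)))

  last≢first : last ≢ first
  last≢first = opposite-≢ {n} first

  opposite-last : opposite last ≡ first
  opposite-last = opposite-involutive first

  opposite≡first : ∀ {l} → opposite l ≡ first → l ≡ last
  opposite≡first {l} l̄≡first = trans (sym (opposite-involutive l)) (cong opposite l̄≡first)

  <last : {i : Fin N} → i ≢ last → toℕ i < toℕ last
  <last {i} i≢last = ≤∧≢⇒< (≤fromℕ i) i≢last

  first< : {i : Fin N} → i ≢ first → toℕ first < toℕ i
  first< {zero}  i≢first = ⊥-elim (i≢first refl)
  first< {suc i} _       = s≤s z≤n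

  data Position (y : Fin N) : Set where
    is-first : y ≡ first → Position y
    is-last  : y ≡ last → Position y
    inner    : y ≢ first → y ≢ last → Position y

  position : ∀ y → Position y
  position y with y ≟ first | y ≟ last
  ... | yes y≡first | _          = is-first y≡first
  ... | no _        | yes y≡last = is-last y≡last
  ... | no y≢first  | no y≢last  = inner y≢first y≢last

  -- u is the identity with its first column and last row filled with ones. Eᵤ only compares indices with
  -- first and last, so u is invariant under permutations fixing both.
  Eᵤ : Mat N
  Eᵤ x y = if δ y first then not (δ x first) else if δ y last then false else δ x last

  u : Mat N
  u = I ⊕ᴹ Eᵤ

  Eᵤ-last : ∀ x → Eᵤ x last ≡ false
  Eᵤ-last x rewrite δ-≢ last≢first | δ-refl last = refl

  Eᵤ-inner : ∀ x {y} → y ≢ first → y ≢ last → Eᵤ x y ≡ δ x last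
  Eᵤ-inner x y≢first y≢last rewrite δ-≢ y≢first | δ-≢ y≢last = refl

  Eᵤ-strictlyLower : StrictlyLower Eᵤ
  Eᵤ-strictlyLower i j i≤j with position j
  ... | is-first refl = cong not (dec-true (i ≟ first) (toℕ-injective (ℕ.n≤0⇒n≡0 i≤j)))
  ... | is-last refl  = Eᵤ-last i
  ... | inner j≢first j≢last =
    trans (Eᵤ-inner i j≢first j≢last)
          (δ-≢ {a = i} {last} λ { refl → ℕ.<⇒≱ (<last j≢last) i≤j })

  Eᵤ-first-row : ∀ y → Eᵤ first y ≡ false
  Eᵤ-first-row y = Eᵤ-strictlyLower first y z≤n

  Eᵤ-against-last : ∀ i → Eᵤ (opposite i) last ≡ Eᵤ (opposite last) i
  Eᵤ-against-last i =
    trans (Eᵤ-last (opposite i)) (sym (trans (cong (λ x → Eᵤ x i) opposite-last) (Eᵤ-first-row i)))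

  Eᵤ-first-against-inner : ∀ {j} → j ≢ first → j ≢ last →
    Eᵤ (opposite first) j ≡ Eᵤ (opposite j) first
  Eᵤ-first-against-inner {j} j≢first j≢last =
    trans (trans (Eᵤ-inner last j≢first j≢last) (δ-refl last))
          (sym (cong not (trans (δ-opposite j first) (δ-≢ j≢last))))

  Eᵤ-inner-against-inner : ∀ {i j} → i ≢ first → j ≢ first → j ≢ last →
    Eᵤ (opposite i) j ≡ false
  Eᵤ-inner-against-inner {i} i≢first j≢first j≢last =
    trans (Eᵤ-inner (opposite i) j≢first j≢last)
          (trans (δ-opposite i last) (trans (cong (δ i) opposite-last) (δ-≢ i≢first)))

  Eᵤ-MSymmetric : MSymmetric Eᵤ
  Eᵤ-MSymmetric i j with position i | position j
  ... | _             | is-last refl  = Eᵤ-against-last i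
  ... | is-last refl  | _             = sym (Eᵤ-against-last j)
  ... | is-first refl | is-first refl = refl
  ... | is-first refl | inner j≢first j≢last = Eᵤ-first-against-inner j≢first j≢last
  ... | inner i≢first i≢last | is-first refl = sym (Eᵤ-first-against-inner i≢first i≢last)
  ... | inner i≢first i≢last | inner j≢first j≢last =
    trans (Eᵤ-inner-against-inner i≢first j≢first j≢last)
          (sym (Eᵤ-inner-against-inner j≢first i≢first i≢last))

  colsum-Eᵤ : ∀ y → colsum Eᵤ y ≡ not (δ y last)
  colsum-Eᵤ y with position y
  ... | is-first refl = begin
    ∑[ x < N ] (true ⊕ δ x first)           ≡⟨ ∑-distrib-+ (λ _ → true) (λ x → δ x first) ⟩
    ∑[ x < N ] true ⊕ ∑[ x < N ] δ x first  ≡⟨ cong₂ _⊕_ (sum-true-even n) (sum-δ first) ⟩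
    true                                    ≡⟨ cong not (δ-≢ (last≢first ∘ sym)) ⟨
    not (δ first last)                      ∎
    where open ≡-Reasoning
  ... | is-last refl = trans (sum-zero Eᵤ-last) (cong not (sym (δ-refl last)))
  ... | inner y≢first y≢last =
    trans (sum-cong-≗ (λ x → Eᵤ-inner x y≢first y≢last))
          (trans (sum-δ last) (cong not (sym (δ-≢ y≢last))))

  Eᵤ-isotropic : Isotropic Eᵤ
  Eᵤ-isotropic i j with position i | position j
  ... | _ | is-last refl = sum-zero (λ l → trans (cong (Eᵤ (opposite l) i ⊗_) (Eᵤ-last l)) (∧-zeroʳ _))
  ... | is-last refl | _ = sum-zero (λ l → cong (_⊗ Eᵤ l j) (Eᵤ-last (opposite l)))
  ... | _ | inner j≢first j≢last = begin
    ⟪ col Eᵤ i , col Eᵤ j ⟫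
      ≡⟨ sum-cong-≗ (λ l → cong (Eᵤ (opposite l) i ⊗_) (Eᵤ-inner l j≢first j≢last)) ⟩
    ⟪ col Eᵤ i , (λ l → δ l last) ⟫       ≡⟨ ⟪,δ⟫ (col Eᵤ i) last ⟩
    Eᵤ (opposite last) i                  ≡⟨ cong (λ x → Eᵤ x i) opposite-last ⟩
    Eᵤ first i                            ≡⟨ Eᵤ-first-row i ⟩
    false                                 ∎
    where open ≡-Reasoning
  ... | inner i≢first i≢last | _ = begin
    ⟪ col Eᵤ i , col Eᵤ j ⟫
      ≡⟨ sum-cong-≗ (λ l → cong (_⊗ Eᵤ l j) (Eᵤ-inner (opposite l) i≢first i≢last)) ⟩
    ⟪ (λ l → δ l last) , col Eᵤ j ⟫       ≡⟨ ⟪δ,⟫ last (col Eᵤ j) ⟩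
    Eᵤ (opposite last) j                  ≡⟨ cong (λ x → Eᵤ x j) opposite-last ⟩
    Eᵤ first j                            ≡⟨ Eᵤ-first-row j ⟩
    false                                 ∎
    where open ≡-Reasoning
  ... | is-first refl | is-first refl = begin
    ⟪ (λ l → true ⊕ δ l first) , col Eᵤ first ⟫
      ≡⟨ ⟪⟫-⊕ˡ (λ _ → true) (λ l → δ l first) (col Eᵤ first) ⟩
    colsum Eᵤ first ⊕ ⟪ (λ l → δ l first) , col Eᵤ first ⟫
      ≡⟨ cong₂ _⊕_ (colsum-Eᵤ first) (⟪δ,⟫ first (col Eᵤ first)) ⟩
    not (δ first last) ⊕ not (δ last first)
      ≡⟨ cong₂ (λ x y → not x ⊕ not y) (δ-≢ (last≢first ∘ sym)) (δ-≢ last≢first) ⟩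
    false ∎
    where open ≡-Reasoning

  u-InUminus : InUminus n u
  u-InUminus = I⊕-InUminus n Eᵤ Eᵤ-strictlyLower Eᵤ-MSymmetric Eᵤ-isotropic

  colsum-u : ∀ y → colsum u y ≡ δ y last
  colsum-u y = trans (colsum-I⊕ Eᵤ y) (trans (cong (true ⊕_) (colsum-Eᵤ y)) (not-involutive (δ y last)))

  u-invariant : (σ : Fin N → Fin N) → (∀ x y → δ (σ x) (σ y) ≡ δ x y) →
    σ first ≡ first → σ last ≡ last → ∀ i j → u (σ i) (σ j) ≡ u i j
  u-invariant σ σ-δ σ-first σ-last i j
    rewrite σ-δ i j | δ-fixed σ σ-δ σ-first i | δ-fixed σ σ-δ σ-first j
                    | δ-fixed σ σ-δ σ-last i  | δ-fixed σ σ-δ σ-last j = refl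

  B⁺-last-diagonal : ∀ {b} → InBplus n b → b last last ≡ true
  B⁺-last-diagonal {b} ((_ , b-symplectic) , b-upper) = ∧-true (begin
    b (opposite last) first ⊗ b last last   ≡⟨ sum-single last first-column-vanishes ⟨
    ⟪ col b first , col b last ⟫             ≡⟨ symplectic-entry n b first last ⟨
    ((b ᵀ) · Mmat n · b) first last          ≡⟨ b-symplectic first last ⟩
    Mmat n first last                        ≡⟨ Mmat-opposite n first last ⟩
    δ first (opposite last)                  ≡⟨ cong (δ first) opposite-last ⟩
    δ first first                            ≡⟨⟩
    true                                     ∎)
    where
    open ≡-Reasoning
    ∧-true : ∀ {x y} → x ⊗ y ≡ true → y ≡ true
    ∧-true {true} y≡true = y≡true
    first-column-vanishes : ∀ l → l ≢ last → b (opposite l) first ⊗ b l last ≡ false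
    first-column-vanishes l l≢last =
      cong (_⊗ b l last) (b-upper (opposite l) first (first< (l≢last ∘ opposite≡first)))

  B⁺-last-row : ∀ {b} → InBplus n b → rowsum b last ≡ true
  B⁺-last-row {b} b∈B⁺ =
    trans (sum-single last (λ j j≢last → proj₂ b∈B⁺ last j (<last j≢last))) (B⁺-last-diagonal b∈B⁺)

  U⁻-last-column : ∀ {v} → InUminus n v → colsum v last ≡ true
  U⁻-last-column {v} (_ , upper≡0 , diag) =
    trans (sum-single last (λ i i≢last → upper≡0 i last (<last i≢last))) (diag last)

  colsum≡e-last⇒odd : ∀ {X} → (∀ y → colsum X y ≡ δ y last) → OddCoset n X
  colsum≡e-last⇒odd {X} colsum-X b b∈B⁺ = Equivalence.from (odd-ones⇔total (X · b)) (begin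
    total (X · b)                            ≡⟨ total-· X b ⟩
    ∑[ y < N ] (colsum X y ⊗ rowsum b y)     ≡⟨ sum-cong-≗ (λ y → cong (_⊗ rowsum b y) (colsum-X y)) ⟩
    ∑[ y < N ] (δ y last ⊗ rowsum b y)       ≡⟨ sum-δˡ (rowsum b) last ⟩
    rowsum b last                            ≡⟨ B⁺-last-row b∈B⁺ ⟩
    true                                     ∎)
    where open ≡-Reasoning

  I∈B⁺ : InBplus n (I ⊕ᴹ (λ _ _ → false))
  I∈B⁺ = I⊕-InBplus n _ (λ _ _ _ → refl) (λ _ _ → refl) (λ _ _ → sum-zero {N} (λ _ → refl))

  I⊕T∈B⁺ : InBplus n (I ⊕ᴹ T[ first ])
  I⊕T∈B⁺ =
    I⊕-InBplus n _ (E-strictlyUpper (first< last≢first)) (T-MSymmetric first) (T-isotropic n first)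

  I⊕S∈B⁺ : ∀ {q} → q ≢ last → InBplus n (I ⊕ᴹ S[ first , q ])
  I⊕S∈B⁺ {q} q≢last =
    I⊕-InBplus n _ (⊕ᴹ-strictlyUpper (E-strictlyUpper (first< q̄≢first)) (E-strictlyUpper (<last q≢last)))
                   (S-MSymmetric first q)
                   (S-isotropic n (q̄≢first ∘ sym))
    where
    q̄≢first : opposite q ≢ first
    q̄≢first = q≢last ∘ opposite≡first

  module _ {X : Mat N} (odd : OddCoset n X) where
    private
      r = colsum X

      cancel : ∀ {x y} → x ≡ true → x ⊕ y ≡ true → y ≡ false
      cancel refl y̅≡true = not-injective y̅≡true

    odd-coset-test : ∀ E {w} → InBplus n (I ⊕ᴹ E) → ∑[ k < N ] (r k ⊗ rowsum E k) ≡ w →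
      ∑[ k < N ] r k ⊕ w ≡ true
    odd-coset-test E {w} b∈B⁺ weight = begin
      ∑[ k < N ] r k ⊕ w                              ≡⟨ cong (∑[ k < N ] r k ⊕_) weight ⟨
      ∑[ k < N ] r k ⊕ ∑[ k < N ] (r k ⊗ rowsum E k)  ≡⟨ ∑-distrib-+ r (λ k → r k ⊗ rowsum E k) ⟨
      ∑[ k < N ] (r k ⊕ r k ⊗ rowsum E k)            ≡⟨ sum-cong-≗ (sym ∘ distribute) ⟩
      ∑[ k < N ] (r k ⊗ rowsum (I ⊕ᴹ E) k)           ≡⟨ total-· X (I ⊕ᴹ E) ⟨
      total (X · (I ⊕ᴹ E))
        ≡⟨ Equivalence.to (odd-ones⇔total (X · (I ⊕ᴹ E))) (odd _ b∈B⁺) ⟩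
      true                                           ∎
      where
      open ≡-Reasoning
      distribute : ∀ k → r k ⊗ rowsum (I ⊕ᴹ E) k ≡ r k ⊕ r k ⊗ rowsum E k
      distribute k = trans (cong (r k ⊗_) (rowsum-I⊕ E k))
                           (trans (∧-distribˡ-xor (r k) true (rowsum E k))
                                  (cong (_⊕ r k ⊗ rowsum E k) (∧-identityʳ (r k))))

    odd-colsum-total : ∑[ k < N ] colsum X k ≡ true
    odd-colsum-total = trans (sym (xor-identityʳ _)) (odd-coset-test (λ _ _ → false) I∈B⁺ weight)
      where
      weight : ∑[ k < N ] (r k ⊗ rowsum {N} (λ _ _ → false) k) ≡ false
      weight = sum-zero (λ k → trans (cong (r k ⊗_) (sum-zero {N} (λ _ → refl))) (∧-zeroʳ (r k)))

    odd-colsum-first : colsum X first ≡ false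
    odd-colsum-first = cancel odd-colsum-total (odd-coset-test T[ first ] I⊕T∈B⁺ weight)
      where
      weight : ∑[ k < N ] (r k ⊗ rowsum T[ first ] k) ≡ r first
      weight = trans (sum-cong-≗ (λ k → cong (r k ⊗_) (rowsum-E first last k))) (sum-δʳ r first)

    odd-colsum-inner : ∀ {q} → q ≢ first → q ≢ last → colsum X q ≡ false
    odd-colsum-inner {q} q≢first q≢last =
      cancel odd-colsum-total (odd-coset-test S[ first , q ] (I⊕S∈B⁺ q≢last) weight)
      where
      open ≡-Reasoning
      weight : ∑[ k < N ] (r k ⊗ rowsum S[ first , q ] k) ≡ r q
      weight = begin
        ∑[ k < N ] (r k ⊗ rowsum S[ first , q ] k)
          ≡⟨ sum-cong-≗ (λ k → trans (cong (r k ⊗_) (rowsum-S first q k))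
                                     (∧-distribˡ-xor (r k) (δ k first) (δ k q))) ⟩
        ∑[ k < N ] (r k ⊗ δ k first ⊕ r k ⊗ δ k q)
          ≡⟨ ∑-distrib-+ (λ k → r k ⊗ δ k first) (λ k → r k ⊗ δ k q) ⟩
        ∑[ k < N ] (r k ⊗ δ k first) ⊕ ∑[ k < N ] (r k ⊗ δ k q)
          ≡⟨ cong₂ _⊕_ (trans (sum-δʳ r first) odd-colsum-first) (sum-δʳ r q) ⟩
        r q ∎

    odd⇒colsum≡e-last : ∀ y → colsum X y ≡ δ y last
    odd⇒colsum≡e-last y = at (position y)
      where
      off-last : ∀ {k} → Position k → k ≢ last → r k ≡ false
      off-last (is-first refl)        _      = odd-colsum-first
      off-last (is-last refl)         k≢last = ⊥-elim (k≢last refl)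
      off-last (inner k≢first k≢last) _      = odd-colsum-inner k≢first k≢last
      at : ∀ {y} → Position y → r y ≡ δ y last
      at (is-first refl)        = trans odd-colsum-first (sym (δ-≢ (last≢first ∘ sym)))
      at (inner y≢first y≢last) = trans (odd-colsum-inner y≢first y≢last) (sym (δ-≢ y≢last))
      at (is-last refl)         = trans (sym (sum-single last (λ k → off-last (position k))))
                                        (trans odd-colsum-total (sym (δ-refl last)))

  u-has-odd-coset : (π : Permutation′ N) → InBn n π → π ⟨$⟩ʳ last ≡ last → HasOddCoset n π
  u-has-odd-coset π π∈Bₙ π-last =
    u , (u-InUminus , u , u-InUminus , u≈conjugate) , colsum≡e-last⇒odd {u · [ π ]} colsum-u[π]
    where
    π-first : π ⟨$⟩ʳ first ≡ first
    π-first = trans (sym (opposite-involutive _))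
                    (trans (cong opposite (trans (sym (π∈Bₙ first)) π-last)) opposite-last)
    π⁻¹-fixes : ∀ {a} → π ⟨$⟩ʳ a ≡ a → π ⟨$⟩ˡ a ≡ a
    π⁻¹-fixes {a} πa≡a = trans (cong (π ⟨$⟩ˡ_) (sym πa≡a)) (inverseˡ π)
    u≈conjugate : u ≈ ([ π ] · u · [ π ]⁻¹)
    u≈conjugate i j =
      sym (trans (conjugate-entry π u i j)
                 (u-invariant (π ⟨$⟩ˡ_) (δ-⟨$⟩ˡ π) (π⁻¹-fixes π-first) (π⁻¹-fixes π-last) i j))
    colsum-u[π] : ∀ x → colsum (u · [ π ]) x ≡ δ x last
    colsum-u[π] x = begin
      colsum (u · [ π ]) x           ≡⟨ colsum-·[π] π u x ⟩
      colsum u (π ⟨$⟩ʳ x)            ≡⟨ colsum-u (π ⟨$⟩ʳ x) ⟩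
      δ (π ⟨$⟩ʳ x) last              ≡⟨ cong (δ (π ⟨$⟩ʳ x)) π-last ⟨
      δ (π ⟨$⟩ʳ x) (π ⟨$⟩ʳ last)     ≡⟨ δ-⟨$⟩ʳ π x last ⟩
      δ x last                       ∎
      where open ≡-Reasoning

  odd-coset-fixes-last : (π : Permutation′ N) → HasOddCoset n π → π ⟨$⟩ʳ last ≡ last
  odd-coset-fixes-last π (u₁ , (u₁∈U⁻ , _) , odd) =
    trans (cong (π ⟨$⟩ʳ_) (sym π⁻¹-last)) (inverseʳ π)
    where
    open ≡-Reasoning
    π⁻¹-last : π ⟨$⟩ˡ last ≡ last
    π⁻¹-last = δ≡true (begin
      δ (π ⟨$⟩ˡ last) last                  ≡⟨ odd⇒colsum≡e-last {u₁ · [ π ]} odd _ ⟨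
      colsum (u₁ · [ π ]) (π ⟨$⟩ˡ last)     ≡⟨ colsum-·[π] π u₁ (π ⟨$⟩ˡ last) ⟩
      colsum u₁ (π ⟨$⟩ʳ (π ⟨$⟩ˡ last))      ≡⟨ cong (colsum u₁) (inverseʳ π) ⟩
      colsum u₁ last                        ≡⟨ U⁻-last-column u₁∈U⁻ ⟩
      true                                  ∎)

lemma4p5 : (n : ℕ) → 1 ≤ n → (π : Permutation′ (n + n)) → InBn n π →
    HasOddCoset n π ⇔ (∀ i → suc (toℕ i) ≡ n + n → π ⟨$⟩ʳ i ≡ i)
lemma4p5 (suc k) _ π π∈Bₙ = mk⇔
  (λ odd i i-last →
    subst (λ j → π ⟨$⟩ʳ j ≡ j) (sym (last-unique k i-last)) (odd-coset-fixes-last k π odd))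
  (λ fixes → u-has-odd-coset k π π∈Bₙ (fixes (last k) (suc-toℕ-last k)))
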